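{- Let $L$ be a co-Brouwerian semilattice satisfying the Splitting Axiom. Then for every finite sub-CBS $L_0\subseteq L$ and every signature $(h_1,h_2,g)$ of the second kind in $L_0$, there exists a primitive couple $(x_1,x_2)\in L^2$ of the second kind over $L_0$ inducing this signature.
   Context: A co-Brouwerian semilattice (CBS) is a poset with least element $0$, binary joins $\vee$ and a difference $-$ characterized by $a-b\le c$ iff $a\le b\vee c$. $a\ll b$ means $a\le b$ and $b-a=b$. Splitting Axiom: for all $a,b_1,b_2$ with $b_1\vee b_2\ll a\ne0$ there exist $a_1,a_2\ne0$ with $a-a_1=a_2\ge b_2$, $a-a_2=a_1\ge b_1$, $b_2-a_1=b_2-b_1$, $b_1-a_2=b_1-b_2$. An element $g$ is join-irreducible if for all $n\ge0$, $g\le b_1\vee\dots\vee b_n$ implies $g\le b_i$ for some $i$; in a finite CBS each join-irreducible $g$ has a unique predecessor $g^-$. A signature of the second kind in a finite CBS $L_0$ is a triple $(h_1,h_2,g)$ with $h_1,h_2\in L_0$, $g$ join-irreducible in $L_0$, and $h_1\vee h_2=g^-$. A pair $(x_1,x_2)\in L^2$ is a primitive couple of the second kind over $L_0$ if $x_1,x_2\notin L_0$, $x_1\neq x_2$, and there is a join-irreducible $g$ of $L_0$ with $g-x_1=x_2$, $g-x_2=x_1$, and $a-x_i\in L_0$ ($i=1,2$) for every join-irreducible $a$ of $L_0$ with $a<g$. It induces $(h_1,h_2,g)$ if $g=x_1\vee x_2$ and for every join-irreducible $a$ of $L_0$ and $i=1,2$: $a<x_i$ iff $a\le h_i$. -}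

module Defs where

open import Data.Product using (Σ; ∃; ∃-syntax; _×_; _,_)
open import Data.Sum using (_⊎_)
open import Data.List using (List; []; _∷_; foldr)
open import Data.List.Membership.Propositional using (_∈_)
open import Data.List.Relation.Unary.All using (All)
open import Data.List.Relation.Unary.Any using (Any)
open import Relation.Binary.PropositionalEquality using (_≡_; _≢_)
open import Relation.Binary.Structures using (IsPartialOrder)
open import Relation.Nullary using (¬_)
open import Function.Bundles using (_⇔_)

record CBS : Set₁ where
  infix 4 _≤_
  infixl 6 _∨_ _-_
  field
    Carrier        : Set
    _≤_            : Carrier → Carrier → Set
    isPartialOrder : IsPartialOrder _≡_ _≤_
    𝟘              : Carrier
    _∨_            : Carrier → Carrier → Carrier
    _-_            : Carrier → Carrier → Carrier
    𝟘-least        : ∀ a → 𝟘 ≤ a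
    ∨-upperˡ       : ∀ a b → a ≤ a ∨ b
    ∨-upperʳ       : ∀ a b → b ≤ a ∨ b
    ∨-least        : ∀ a b c → a ≤ c → b ≤ c → a ∨ b ≤ c
    diff-adj       : ∀ a b c → (a - b ≤ c) ⇔ (a ≤ b ∨ c)

module _ (L : CBS) where
  open CBS L

  infix 4 _<_ _≪_
  _<_ : Carrier → Carrier → Set
  a < b = a ≤ b × a ≢ b

  _≪_ : Carrier → Carrier → Set
  a ≪ b = a ≤ b × b - a ≡ b

  SplittingAxiom : Set
  SplittingAxiom =
    ∀ a b₁ b₂ → b₁ ∨ b₂ ≪ a → a ≢ 𝟘 →
    ∃[ a₁ ] ∃[ a₂ ] (a₁ ≢ 𝟘 × a₂ ≢ 𝟘
      × a - a₁ ≡ a₂ × b₂ ≤ a₂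
      × a - a₂ ≡ a₁ × b₁ ≤ a₁
      × b₂ - a₁ ≡ b₂ - b₁
      × b₁ - a₂ ≡ b₁ - b₂)

  record FiniteSubCBS : Set₁ where
    field
      Mem     : Carrier → Set
      𝟘-mem   : Mem 𝟘
      ∨-mem   : ∀ {a b} → Mem a → Mem b → Mem (a ∨ b)
      −-mem   : ∀ {a b} → Mem a → Mem b → Mem (a - b)
      elems   : List Carrier
      elems-complete : ∀ {a} → Mem a → a ∈ elems
      elems-sound    : ∀ {a} → a ∈ elems → Mem a

  module _ (L₀ : FiniteSubCBS) where
    open FiniteSubCBS L₀

    ⋁ : List Carrier → Carrier
    ⋁ = foldr _∨_ 𝟘

    JoinIrreducible : Carrier → Set
    JoinIrreducible g =
      Mem g × (∀ (bs : List Carrier) → All Mem bs → g ≤ ⋁ bs → Any (g ≤_) bs)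

    IsPredecessor : Carrier → Carrier → Set
    IsPredecessor p g = Mem p × p < g × (∀ c → Mem c → p < c → ¬ (c < g))

    SignatureII : Carrier → Carrier → Carrier → Set
    SignatureII h₁ h₂ g =
      Mem h₁ × Mem h₂ × JoinIrreducible g × IsPredecessor (h₁ ∨ h₂) g

    PrimitiveCoupleII : Carrier → Carrier → Set
    PrimitiveCoupleII x₁ x₂ =
      ¬ Mem x₁ × ¬ Mem x₂ × x₁ ≢ x₂ ×
      ∃[ g ] (JoinIrreducible g × g - x₁ ≡ x₂ × g - x₂ ≡ x₁
              × (∀ a → JoinIrreducible a → a < g → Mem (a - x₁) × Mem (a - x₂)))

    InducesII : Carrier → Carrier → Carrier → Carrier → Carrier → Set
    InducesII x₁ x₂ h₁ h₂ g =
      g ≡ x₁ ∨ x₂ ×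
      (∀ a → JoinIrreducible a → ((a < x₁) ⇔ (a ≤ h₁)) × ((a < x₂) ⇔ (a ≤ h₂)))

-- Since g is join-irreducible with predecessor h₁ ∨ h₂, the element h₁ ∨ h₂ is
-- disjoint from g (g - (h₁ ∨ h₂) = g), so the Splitting Axiom splits g into
-- complementary nonzero parts x₁ ≥ h₁, x₂ ≥ h₂. What remains is a - xᵢ = a - hᵢ
-- for the finitely many join-irreducibles a < g of L₀, all of which lie below
-- h₁ ∨ h₂. For one such u, splitting x₁ again separates u ↾ x₁ from h₁; moving
-- that piece over to x₂ gives u - x₁ = u - h₁, and this survives any further
-- shrinking of x₁. Once all of x₁'s agreements hold we treat x₂ the same way, but
-- every piece moved to x₁ is first split, again by the axiom, against each element
-- already handled, so that those agreements are not destroyed. Finally xᵢ ∉ L₀,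
-- since otherwise join-irreducibility of g = x₁ ∨ x₂ would make one part 0.
module Submission where

open import Defs
open import Data.Product using (Σ; ∃-syntax; _×_; _,_; proj₁; proj₂)
open import Data.Sum using (_⊎_; inj₁; inj₂)
open import Data.Empty using (⊥-elim)
open import Data.List using (List; []; _∷_; map)
open import Data.List.Relation.Unary.All as All using (All; []; _∷_)
open import Data.List.Relation.Unary.All.Properties using (map⁺; map⁻)
open import Data.List.Relation.Unary.Any using (here; there)
open import Relation.Binary.Bundles using (Poset)
open import Relation.Binary.PropositionalEquality using (_≡_; _≢_; sym; subst; cong)
open import Relation.Binary.Structures using (IsPartialOrder)
open import Relation.Nullary using (¬_)
open import Function.Bundles using (_⇔_; mk⇔; Equivalence)

module Descent {S A : Set} (_⊑_ : S → S → Set)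
  (⊑-refl : ∀ {X} → X ⊑ X) (⊑-trans : ∀ {X Y Z} → X ⊑ Y → Y ⊑ Z → X ⊑ Z)
  (P : A → Set) (Q : A → S → Set) (Q-stable : ∀ {a X Y} → Y ⊑ X → Q a X → Q a Y)
  (step : ∀ {a} → P a → ∀ X → ∃[ Y ] (Y ⊑ X × Q a Y)) where

  descend : ∀ {as} → All P as → ∀ X → ∃[ Y ] (Y ⊑ X × All (λ a → Q a Y) as)
  descend [] X = X , ⊑-refl , []
  descend (pa ∷ pas) X with step pa X
  ... | X₁ , X₁⊑X , qa with descend pas X₁
  ... | Y , Y⊑X₁ , qas = Y , ⊑-trans Y⊑X₁ X₁⊑X , Q-stable Y⊑X₁ qa ∷ qas

module Properties (L : CBS) where
  open CBS L

  open IsPartialOrder isPartialOrder public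
    using (antisym) renaming (refl to ≤-refl; trans to ≤-trans; reflexive to ≤-reflexive)

  poset : Poset _ _ _
  poset = record { Carrier = Carrier ; _≈_ = _≡_ ; _≤_ = _≤_ ; isPartialOrder = isPartialOrder }

  open import Relation.Binary.Reasoning.PartialOrder poset public

  diff≤⇒≤∨ : ∀ {x y z} → x - y ≤ z → x ≤ y ∨ z
  diff≤⇒≤∨ {x} {y} {z} = Equivalence.to (diff-adj x y z)

  ≤∨⇒diff≤ : ∀ {x y z} → x ≤ y ∨ z → x - y ≤ z
  ≤∨⇒diff≤ {x} {y} {z} = Equivalence.from (diff-adj x y z)

  ∨-lub : ∀ {x y z} → x ≤ z → y ≤ z → x ∨ y ≤ z
  ∨-lub = ∨-least _ _ _

  x≤y⇒x≤y∨z : ∀ {x y z} → x ≤ y → x ≤ y ∨ z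
  x≤y⇒x≤y∨z x≤y = ≤-trans x≤y (∨-upperˡ _ _)

  x≤z⇒x≤y∨z : ∀ {x y z} → x ≤ z → x ≤ y ∨ z
  x≤z⇒x≤y∨z x≤z = ≤-trans x≤z (∨-upperʳ _ _)

  ∨-mono-≤ : ∀ {x x′ y y′} → x ≤ x′ → y ≤ y′ → x ∨ y ≤ x′ ∨ y′
  ∨-mono-≤ x≤x′ y≤y′ = ∨-lub (x≤y⇒x≤y∨z x≤x′) (x≤z⇒x≤y∨z y≤y′)

  ∨-comm : ∀ x y → x ∨ y ≡ y ∨ x
  ∨-comm x y = antisym swap≤ swap≤
    where
      swap≤ : ∀ {a b} → a ∨ b ≤ b ∨ a
      swap≤ = ∨-lub (x≤z⇒x≤y∨z ≤-refl) (x≤y⇒x≤y∨z ≤-refl)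

  ∨-assoc : ∀ {x y z} → (x ∨ y) ∨ z ≡ x ∨ (y ∨ z)
  ∨-assoc = antisym
    (∨-lub (∨-mono-≤ ≤-refl (x≤y⇒x≤y∨z ≤-refl)) (x≤z⇒x≤y∨z (x≤z⇒x≤y∨z ≤-refl)))
    (∨-lub (x≤y⇒x≤y∨z (x≤y⇒x≤y∨z ≤-refl)) (∨-mono-≤ (x≤z⇒x≤y∨z ≤-refl) ≤-refl))

  x≤𝟘⇒x≡𝟘 : ∀ {x} → x ≤ 𝟘 → x ≡ 𝟘
  x≤𝟘⇒x≡𝟘 x≤𝟘 = antisym x≤𝟘 (𝟘-least _)

  x≢𝟘⇒x∨y≢𝟘 : ∀ {x y} → x ≢ 𝟘 → x ∨ y ≢ 𝟘
  x≢𝟘⇒x∨y≢𝟘 x≢𝟘 x∨y≡𝟘 = x≢𝟘 (x≤𝟘⇒x≡𝟘 (≤-trans (x≤y⇒x≤y∨z ≤-refl) (≤-reflexive x∨y≡𝟘)))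

  x≤y∨[x-y] : ∀ {x y} → x ≤ y ∨ (x - y)
  x≤y∨[x-y] = diff≤⇒≤∨ ≤-refl

  x-y≤x : ∀ {x y} → x - y ≤ x
  x-y≤x = ≤∨⇒diff≤ (x≤z⇒x≤y∨z ≤-refl)

  diff-monoˡ-≤ : ∀ {x y z} → x ≤ y → x - z ≤ y - z
  diff-monoˡ-≤ x≤y = ≤∨⇒diff≤ (≤-trans x≤y x≤y∨[x-y])

  diff-antiʳ-≤ : ∀ {x y z} → y ≤ z → x - z ≤ x - y
  diff-antiʳ-≤ y≤z = ≤∨⇒diff≤ (≤-trans x≤y∨[x-y] (∨-mono-≤ y≤z ≤-refl))

  x≤y⇒x-y≡𝟘 : ∀ {x y} → x ≤ y → x - y ≡ 𝟘
  x≤y⇒x-y≡𝟘 x≤y = x≤𝟘⇒x≡𝟘 (≤∨⇒diff≤ (x≤y⇒x≤y∨z x≤y))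

  x≤x-𝟘 : ∀ {x} → x ≤ x - 𝟘
  x≤x-𝟘 = ≤-trans x≤y∨[x-y] (∨-lub (𝟘-least _) ≤-refl)

  diff-∨ : ∀ {x y z} → (x - y) - z ≡ x - (y ∨ z)
  diff-∨ {x} {y} {z} = antisym
    (≤∨⇒diff≤ (≤∨⇒diff≤ (begin
      x                         ≤⟨ x≤y∨[x-y] ⟩
      (y ∨ z) ∨ (x - (y ∨ z))  ≡⟨ ∨-assoc ⟩
      y ∨ (z ∨ (x - (y ∨ z)))  ∎)))
    (≤∨⇒diff≤ (begin
      x                         ≤⟨ x≤y∨[x-y] ⟩
      y ∨ (x - y)               ≤⟨ ∨-mono-≤ ≤-refl x≤y∨[x-y] ⟩
      y ∨ (z ∨ ((x - y) - z))   ≡⟨ sym ∨-assoc ⟩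
      (y ∨ z) ∨ ((x - y) - z)   ∎))

  x-y≤[x-y]-y : ∀ {x y} → x - y ≤ (x - y) - y
  x-y≤[x-y]-y {x} {y} = begin
    x - y        ≤⟨ diff-antiʳ-≤ (∨-lub ≤-refl ≤-refl) ⟩
    x - (y ∨ y)  ≡⟨ sym diff-∨ ⟩
    (x - y) - y  ∎

  diff-distribʳ-∨ : ∀ {x y z} → (x ∨ y) - z ≤ (x - z) ∨ (y - z)
  diff-distribʳ-∨ = ≤∨⇒diff≤ (∨-lub
    (≤-trans x≤y∨[x-y] (∨-mono-≤ ≤-refl (x≤y⇒x≤y∨z ≤-refl)))
    (≤-trans x≤y∨[x-y] (∨-mono-≤ ≤-refl (x≤z⇒x≤y∨z ≤-refl))))

  -- A lower bound of x and y, but in general not their meet.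
  infixl 7 _↾_
  _↾_ : Carrier → Carrier → Carrier
  x ↾ y = x - (x - y)

  ↾-≤ˡ : ∀ {x y} → x ↾ y ≤ x
  ↾-≤ˡ = x-y≤x

  ↾-≤ʳ : ∀ {x y} → x ↾ y ≤ y
  ↾-≤ʳ {x} {y} = ≤∨⇒diff≤ (≤-trans x≤y∨[x-y] (≤-reflexive (∨-comm y (x - y))))

  x≤y⇒x↾y≡x : ∀ {x y} → x ≤ y → x ↾ y ≡ x
  x≤y⇒x↾y≡x {x} {y} x≤y = antisym ↾-≤ˡ (begin
    x            ≤⟨ x≤x-𝟘 ⟩
    x - 𝟘        ≡⟨ cong (x -_) (sym (x≤y⇒x-y≡𝟘 x≤y)) ⟩
    x - (x - y)  ∎)

  infix 4 _#_
  _#_ : Carrier → Carrier → Set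
  v # x = x ≤ x - v

  #-antiˡ : ∀ {u v x} → u ≤ v → v # x → u # x
  #-antiˡ u≤v v#x = ≤-trans v#x (diff-antiʳ-≤ u≤v)

  #-diff : ∀ {v x y} → v # x → v # x - y
  #-diff {v} {x} {y} v#x = begin
    x - y        ≤⟨ diff-monoˡ-≤ v#x ⟩
    (x - v) - y  ≡⟨ diff-∨ ⟩
    x - (v ∨ y)  ≡⟨ cong (x -_) (∨-comm v y) ⟩
    x - (y ∨ v)  ≡⟨ sym diff-∨ ⟩
    (x - y) - v  ∎

  record IsSplit (c x y : Carrier) : Set where
    field
      c-x≡y : c - x ≡ y
      c-y≡x : c - y ≡ x

    x≤c : x ≤ c
    x≤c = ≤-trans (≤-reflexive (sym c-y≡x)) x-y≤x

    c≤x∨y : c ≤ x ∨ y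
    c≤x∨y = diff≤⇒≤∨ (≤-reflexive c-x≡y)

    c≡x∨y : c ≡ x ∨ y
    c≡x∨y = antisym c≤x∨y (∨-lub x≤c (≤-trans (≤-reflexive (sym c-x≡y)) x-y≤x))

    c≤x⇒y≡𝟘 : c ≤ x → y ≡ 𝟘
    c≤x⇒y≡𝟘 c≤x = subst (_≡ 𝟘) c-x≡y (x≤y⇒x-y≡𝟘 c≤x)

    x≢y : y ≢ 𝟘 → x ≢ y
    x≢y y≢𝟘 x≡y = y≢𝟘 (c≤x⇒y≡𝟘 (≤-trans c≤x∨y (∨-lub ≤-refl (≤-reflexive (sym x≡y)))))

    #ˡ : ∀ {v} → v # c → v # x
    #ˡ {v} v#c = subst (v #_) c-y≡x (#-diff v#c)

  swap : ∀ {c x y} → IsSplit c x y → IsSplit c y x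
  swap s = record { c-x≡y = IsSplit.c-y≡x s ; c-y≡x = IsSplit.c-x≡y s }

  refine : ∀ {c x y x₁ x₂} → IsSplit c x y → IsSplit x x₁ x₂ → IsSplit c x₁ (y ∨ x₂)
  refine {c} {x} {y} {x₁} {x₂} s t = record
    { c-x≡y = antisym
        (≤∨⇒diff≤ (begin
          c                   ≤⟨ S.c≤x∨y ⟩
          x ∨ y               ≤⟨ ∨-mono-≤ T.c≤x∨y ≤-refl ⟩
          (x₁ ∨ x₂) ∨ y       ≡⟨ ∨-assoc ⟩
          x₁ ∨ (x₂ ∨ y)       ≡⟨ cong (x₁ ∨_) (∨-comm x₂ y) ⟩
          x₁ ∨ (y ∨ x₂)       ∎))
        (∨-lub (≤-trans (≤-reflexive (sym S.c-x≡y)) (diff-antiʳ-≤ T.x≤c))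
               (≤-trans (≤-reflexive (sym T.c-x≡y)) (diff-monoˡ-≤ S.x≤c)))
    ; c-y≡x = begin-equality
        c - (y ∨ x₂)  ≡⟨ sym diff-∨ ⟩
        (c - y) - x₂  ≡⟨ cong (_- x₂) S.c-y≡x ⟩
        x - x₂        ≡⟨ T.c-y≡x ⟩
        x₁            ∎
    }
    where
      module S = IsSplit s
      module T = IsSplit t

  #ʳ : ∀ {c x y v} → IsSplit c x y → v # c → v # y
  #ʳ s = IsSplit.#ˡ (swap s)

  record Splitting (c b₁ b₂ : Carrier) : Set where
    field
      x₁ x₂   : Carrier
      isSplit : IsSplit c x₁ x₂
      b₁≤x₁   : b₁ ≤ x₁
      b₂≤x₂   : b₂ ≤ x₂
      x₁≢𝟘    : x₁ ≢ 𝟘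
      x₂≢𝟘    : x₂ ≢ 𝟘

  open Splitting public

  swapSplitting : ∀ {c b₁ b₂} → Splitting c b₁ b₂ → Splitting c b₂ b₁
  swapSplitting S = record
    { x₁ = x₂ S ; x₂ = x₁ S ; isSplit = swap (isSplit S)
    ; b₁≤x₁ = b₂≤x₂ S ; b₂≤x₂ = b₁≤x₁ S ; x₁≢𝟘 = x₂≢𝟘 S ; x₂≢𝟘 = x₁≢𝟘 S }

  weakenʳ : ∀ {c b₁ b₂ b₂′} → b₂′ ≤ b₂ → Splitting c b₁ b₂ → Splitting c b₁ b₂′
  weakenʳ b₂′≤b₂ S = record
    { x₁ = x₁ S ; x₂ = x₂ S ; isSplit = isSplit S
    ; b₁≤x₁ = b₁≤x₁ S ; b₂≤x₂ = ≤-trans b₂′≤b₂ (b₂≤x₂ S) ; x₁≢𝟘 = x₁≢𝟘 S ; x₂≢𝟘 = x₂≢𝟘 S }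

  refineˡ : ∀ {c b₁ b₂ b₁′ b₃} (S : Splitting c b₁ b₂) →
            Splitting (x₁ S) b₁′ b₃ → Splitting c b₁′ b₂
  refineˡ S T = record
    { x₁ = x₁ T ; x₂ = x₂ S ∨ x₂ T ; isSplit = refine (isSplit S) (isSplit T)
    ; b₁≤x₁ = b₁≤x₁ T ; b₂≤x₂ = x≤y⇒x≤y∨z (b₂≤x₂ S)
    ; x₁≢𝟘 = x₁≢𝟘 T ; x₂≢𝟘 = x≢𝟘⇒x∨y≢𝟘 (x₂≢𝟘 S) }

  refineʳ : ∀ {c b₁ b₂ b₂′ b₃} (S : Splitting c b₁ b₂) →
            Splitting (x₂ S) b₂′ b₃ → Splitting c b₁ b₂′
  refineʳ S T = swapSplitting (refineˡ (swapSplitting S) T)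

  split : SplittingAxiom L → ∀ {a b₁ b₂} → b₁ ∨ b₂ ≤ a → b₁ ∨ b₂ # a → a ≢ 𝟘 →
          Σ (Splitting a b₁ b₂) λ S → b₂ - x₁ S ≡ b₂ - b₁ × b₁ - x₂ S ≡ b₁ - b₂
  split SA {a} {b₁} {b₂} b≤a b#a a≢𝟘 with SA a b₁ b₂ (b≤a , antisym x-y≤x b#a) a≢𝟘
  ... | a₁ , a₂ , a₁≢𝟘 , a₂≢𝟘 , a-a₁≡a₂ , b₂≤a₂ , a-a₂≡a₁ , b₁≤a₁ , b₂-a₁≡b₂-b₁ , b₁-a₂≡b₁-b₂ =
    record { x₁ = a₁ ; x₂ = a₂ ; isSplit = record { c-x≡y = a-a₁≡a₂ ; c-y≡x = a-a₂≡a₁ }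
           ; b₁≤x₁ = b₁≤a₁ ; b₂≤x₂ = b₂≤a₂ ; x₁≢𝟘 = a₁≢𝟘 ; x₂≢𝟘 = a₂≢𝟘 }
    , b₂-a₁≡b₂-b₁ , b₁-a₂≡b₁-b₂

module Construction (L : CBS) (SA : SplittingAxiom L) where
  open CBS L
  open Properties L

  module Phase (g hs ht : Carrier) (hs∨ht#g : hs ∨ ht # g)
               {vs : List Carrier} (vs≤ : All (_≤ hs ∨ ht) vs) where

    v-hs≤ht : ∀ {v} → v ≤ hs ∨ ht → v - hs ≤ ht
    v-hs≤ht = ≤∨⇒diff≤

    v-ht≤hs : ∀ {v} → v ≤ hs ∨ ht → v - ht ≤ hs
    v-ht≤hs v≤ = ≤∨⇒diff≤ (≤-trans v≤ (≤-reflexive (∨-comm hs ht)))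

    Protected : Splitting g hs ht → Carrier → Set
    Protected X v = v - ht ≤ v - x₂ X

    Guarded : Set
    Guarded = Σ (Splitting g hs ht) λ X → All (Protected X) vs

    module Absorb (X : Splitting g hs ht) (prot : All (Protected X) vs)
                  {u : Carrier} (u≤ : u ≤ hs ∨ ht) where

      s e p : Carrier
      s = x₁ X
      e = u ↾ s
      p = e - hs

      p≤ht : p ≤ ht
      p≤ht = ≤-trans (diff-monoˡ-≤ ↾-≤ˡ) (v-hs≤ht u≤)

      -- p ≤ e - z keeps e - hs away from the part z that stays in x₁; this is what
      -- yields u - hs ≤ u - z in `absorbed`.
      Shrinking : Set
      Shrinking = Σ (Splitting s hs p) λ Z → p ≤ e - x₁ Z

      _⊑_ : Shrinking → Shrinking → Set
      Z′ ⊑ Z = x₂ (proj₁ Z′) ≤ x₂ (proj₁ Z)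

      Shielded : Carrier → Shrinking → Set
      Shielded v Z = x₂ (proj₁ Z) # v - ht

      shield : ∀ {v} → v ≤ hs ∨ ht → ∀ Z → ∃[ Z′ ] (Z′ ⊑ Z × Shielded v Z′)
      shield {v} v≤ (Z , p≤e-z)
        with split SA (∨-lub (b₂≤x₂ Z) ↾-≤ʳ) p∨q#w (x₂≢𝟘 Z)
        where
          p∨q#w : p ∨ (v - ht) ↾ x₂ Z # x₂ Z
          p∨q#w = #ʳ (isSplit Z) (IsSplit.#ˡ (isSplit X)
            (#-antiˡ (∨-lub (≤-trans x-y≤x (≤-trans ↾-≤ˡ u≤))
                            (≤-trans ↾-≤ˡ (≤-trans x-y≤x v≤))) hs∨ht#g))
      ... | K , q-k≡q-p , p-r≡p-q = (refineʳ Z K , p≤e-z′) , k≤w , k#f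
        where
          z w f q k r : Carrier
          z = x₁ Z
          w = x₂ Z
          f = v - ht
          q = f ↾ w
          k = x₁ K
          r = x₂ K

          k≤w : k ≤ w
          k≤w = IsSplit.x≤c (isSplit K)

          p≤e-z′ : p ≤ e - (z ∨ r)
          p≤e-z′ = begin
            p              ≤⟨ x-y≤[x-y]-y ⟩
            p - hs         ≤⟨ diff-antiʳ-≤ (≤-trans ↾-≤ˡ (v-ht≤hs v≤)) ⟩
            p - q          ≡⟨ sym p-r≡p-q ⟩
            p - r          ≤⟨ diff-monoˡ-≤ p≤e-z ⟩
            (e - z) - r    ≡⟨ diff-∨ ⟩
            e - (z ∨ r)    ∎

          k#f : k # f
          k#f = begin
            f                          ≤⟨ x-y≤[x-y]-y ⟩
            f - ht                     ≤⟨ diff-monoˡ-≤ x≤y∨[x-y] ⟩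
            ((f - w) ∨ q) - ht         ≤⟨ diff-distribʳ-∨ ⟩
            ((f - w) - ht) ∨ (q - ht)  ≤⟨ ∨-mono-≤ x-y≤x (diff-antiʳ-≤ p≤ht) ⟩
            (f - w) ∨ (q - p)          ≡⟨ cong ((f - w) ∨_) (sym q-k≡q-p) ⟩
            (f - w) ∨ (q - k)          ≤⟨ ∨-lub (diff-antiʳ-≤ k≤w) (diff-monoˡ-≤ ↾-≤ˡ) ⟩
            f - k                      ∎

      initial : Σ (Splitting s hs e) λ Z → e - x₁ Z ≡ e - hs × hs - x₂ Z ≡ hs - e
      initial = split SA (∨-lub (b₁≤x₁ X) ↾-≤ʳ)
        (IsSplit.#ˡ (isSplit X) (#-antiˡ (∨-lub (x≤y⇒x≤y∨z ≤-refl) (≤-trans ↾-≤ˡ u≤)) hs∨ht#g))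
        (x₁≢𝟘 X)

      shrinking₀ : Shrinking
      shrinking₀ = weakenʳ x-y≤x (proj₁ initial) , ≤-reflexive (sym (proj₁ (proj₂ initial)))

      shrunk : ∃[ Z ] (Z ⊑ shrinking₀ × All (λ v → Shielded v Z) vs)
      shrunk = Descent.descend _⊑_ ≤-refl ≤-trans (_≤ hs ∨ ht) Shielded #-antiˡ shield vs≤ shrinking₀

      Z : Splitting s hs p
      Z = proj₁ (proj₁ shrunk)

      Y : Splitting g hs ht
      Y = refineˡ X Z

      protected : All (Protected Y) vs
      protected = All.zipWith protect (prot , proj₂ (proj₂ shrunk))
        where
          protect : ∀ {v} → Protected X v × x₂ Z # v - ht → Protected Y v
          protect {v} (v-ht≤v-t , w#f) = begin
            v - ht               ≤⟨ w#f ⟩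
            (v - ht) - x₂ Z      ≤⟨ diff-monoˡ-≤ v-ht≤v-t ⟩
            (v - x₂ X) - x₂ Z    ≡⟨ diff-∨ ⟩
            v - (x₂ X ∨ x₂ Z)    ∎

      z≤s : x₁ Z ≤ s
      z≤s = IsSplit.x≤c (isSplit Z)

      absorbed : u - hs ≤ u - x₁ Z
      absorbed = begin
        u - hs                  ≤⟨ diff-monoˡ-≤ x≤y∨[x-y] ⟩
        ((u - s) ∨ e) - hs      ≤⟨ diff-distribʳ-∨ ⟩
        ((u - s) - hs) ∨ p      ≤⟨ ∨-lub (≤-trans x-y≤x (diff-antiʳ-≤ z≤s))
                                         (≤-trans (proj₂ (proj₁ shrunk)) (diff-monoˡ-≤ ↾-≤ˡ)) ⟩
        u - x₁ Z                ∎

    absorb : ∀ {u} → u ≤ hs ∨ ht → (X : Guarded) →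
             Σ Guarded λ Y → x₁ (proj₁ Y) ≤ x₁ (proj₁ X) × u - hs ≤ u - x₁ (proj₁ Y)
    absorb u≤ (X , prot) = (Y , protected) , z≤s , absorbed
      where open Absorb X prot u≤

    phase : ∀ {us} → All (_≤ hs ∨ ht) us → (X : Guarded) →
            Σ Guarded λ Y → x₁ (proj₁ Y) ≤ x₁ (proj₁ X) × All (λ u → u - hs ≤ u - x₁ (proj₁ Y)) us
    phase = Descent.descend (λ Y X → x₁ (proj₁ Y) ≤ x₁ (proj₁ X)) ≤-refl ≤-trans
      (_≤ hs ∨ ht) (λ u Y → u - hs ≤ u - x₁ (proj₁ Y))
      (λ Y⊑X u-hs≤ → ≤-trans u-hs≤ (diff-antiʳ-≤ Y⊑X)) absorb

  refinement : ∀ {g h₁ h₂} → g ≢ 𝟘 → h₁ ∨ h₂ ≤ g → h₁ ∨ h₂ # g →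
               ∀ {us} → All (_≤ h₁ ∨ h₂) us →
               Σ (Splitting g h₁ h₂) λ X →
                 All (λ u → u - h₁ ≤ u - x₁ X × u - h₂ ≤ u - x₂ X) us
  refinement {g} {h₁} {h₂} g≢𝟘 h≤g h#g {us} us≤
    with Phase.phase g h₁ h₂ h#g [] us≤ (proj₁ (split SA h≤g h#g g≢𝟘) , [])
  ... | (X₁ , _) , _ , agree₁
    with Phase.phase g h₂ h₁ (subst (_# g) (∨-comm h₁ h₂) h#g) us≤′ us≤′ (swapSplitting X₁ , agree₁)
    where
      us≤′ : All (_≤ h₂ ∨ h₁) us
      us≤′ = subst (λ h → All (_≤ h) us) (∨-comm h₁ h₂) us≤
  ... | (X₂ , agree₁′) , _ , agree₂ = swapSplitting X₂ , All.zip (agree₁′ , agree₂)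

module Irreducibility (L : CBS) (L₀ : FiniteSubCBS L) where
  open CBS L
  open Properties L
  open FiniteSubCBS L₀

  ji-∨ : ∀ {a b c} → JoinIrreducible L L₀ a → Mem b → Mem c → a ≤ b ∨ c → a ≤ b ⊎ a ≤ c
  ji-∨ (_ , irreducible) b∈ c∈ a≤b∨c
    with irreducible (_ ∷ _ ∷ []) (b∈ ∷ c∈ ∷ []) (≤-trans a≤b∨c (∨-mono-≤ ≤-refl (x≤y⇒x≤y∨z ≤-refl)))
  ... | here a≤b = inj₁ a≤b
  ... | there (here a≤c) = inj₂ a≤c

  ji≢𝟘 : ∀ {a} → JoinIrreducible L L₀ a → a ≢ 𝟘
  ji≢𝟘 (_ , irreducible) a≡𝟘 with irreducible [] [] (≤-reflexive a≡𝟘)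
  ... | ()

  ji-≤⊎# : ∀ {a h} → JoinIrreducible L L₀ a → Mem h → a ≤ h ⊎ h # a
  ji-≤⊎# a-irr h∈ = ji-∨ a-irr h∈ (−-mem (proj₁ a-irr) h∈) x≤y∨[x-y]

  predecessor# : ∀ {p g} → JoinIrreducible L L₀ g → IsPredecessor L L₀ p g → p # g
  predecessor# g-irr (p∈ , (p≤g , p≢g) , _) with ji-≤⊎# g-irr p∈
  ... | inj₁ g≤p = ⊥-elim (p≢g (antisym p≤g g≤p))
  ... | inj₂ p#g = p#g

  -- Otherwise a ∨ p would lie strictly between the predecessor p and g.
  ≤predecessor : ∀ {a p g} → JoinIrreducible L L₀ g → IsPredecessor L L₀ p g →
                 JoinIrreducible L L₀ a → a ≤ g → a ≢ g → a ≤ p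
  ≤predecessor {a} {p} {g} g-irr (p∈ , (p≤g , p≢g) , covers) a-irr a≤g a≢g
    with ji-≤⊎# a-irr p∈
  ... | inj₁ a≤p = a≤p
  ... | inj₂ p#a = ⊥-elim (covers (a ∨ p) (∨-mem (proj₁ a-irr) p∈)
          (x≤z⇒x≤y∨z ≤-refl , p≢a∨p) (∨-lub a≤g p≤g , a∨p≢g))
    where
      p≢a∨p : p ≢ a ∨ p
      p≢a∨p p≡a∨p = ji≢𝟘 a-irr (x≤𝟘⇒x≡𝟘 (begin
        a      ≤⟨ p#a ⟩
        a - p  ≡⟨ x≤y⇒x-y≡𝟘 (≤-trans (x≤y⇒x≤y∨z ≤-refl) (≤-reflexive (sym p≡a∨p))) ⟩
        𝟘      ∎))

      a∨p≢g : a ∨ p ≢ g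
      a∨p≢g a∨p≡g with ji-∨ g-irr (proj₁ a-irr) p∈ (≤-reflexive (sym a∨p≡g))
      ... | inj₁ g≤a = a≢g (antisym a≤g g≤a)
      ... | inj₂ g≤p = p≢g (antisym p≤g g≤p)

  module Side {g x y h} (g-irr : JoinIrreducible L L₀ g) (g=x+y : IsSplit g x y)
              (x≢𝟘 : x ≢ 𝟘) (y≢𝟘 : y ≢ 𝟘) (h≤x : h ≤ x) (h∈ : Mem h)
              (agrees : ∀ {a} → JoinIrreducible L L₀ a → a ≤ g → a ≢ g → a - h ≤ a - x) where
    open IsSplit g=x+y

    x∉L₀ : ¬ Mem x
    x∉L₀ x∈ with ji-∨ g-irr x∈ (subst Mem c-x≡y (−-mem (proj₁ g-irr) x∈)) c≤x∨y
    ... | inj₁ g≤x = y≢𝟘 (c≤x⇒y≡𝟘 g≤x)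
    ... | inj₂ g≤y = x≢𝟘 (IsSplit.c≤x⇒y≡𝟘 (swap g=x+y) g≤y)

    diff-mem : ∀ {a} → JoinIrreducible L L₀ a → a ≤ g → a ≢ g → Mem (a - x)
    diff-mem a-irr a≤g a≢g =
      subst Mem (antisym (agrees a-irr a≤g a≢g) (diff-antiʳ-≤ h≤x)) (−-mem (proj₁ a-irr) h∈)

    induced : ∀ {a} → JoinIrreducible L L₀ a → (a ≤ x × a ≢ x) ⇔ a ≤ h
    induced {a} a-irr = mk⇔ below above
      where
        below : a ≤ x × a ≢ x → a ≤ h
        below (a≤x , _) with ji-≤⊎# a-irr h∈
        ... | inj₁ a≤h = a≤h
        ... | inj₂ h#a = ⊥-elim (ji≢𝟘 a-irr (x≤𝟘⇒x≡𝟘 (begin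
          a      ≤⟨ h#a ⟩
          a - h  ≤⟨ agrees a-irr (≤-trans a≤x x≤c) a≢g ⟩
          a - x  ≡⟨ x≤y⇒x-y≡𝟘 a≤x ⟩
          𝟘      ∎)))
          where
            a≢g : a ≢ g
            a≢g a≡g = y≢𝟘 (c≤x⇒y≡𝟘 (subst (_≤ x) a≡g a≤x))

        above : a ≤ h → a ≤ x × a ≢ x
        above a≤h = ≤-trans a≤h h≤x , λ a≡x → x∉L₀ (subst Mem a≡x (proj₁ a-irr))

  primitive-inducing :
    ∀ {g h₁ h₂} → JoinIrreducible L L₀ g → Mem h₁ → Mem h₂ → (X : Splitting g h₁ h₂) →
    (∀ {a} → JoinIrreducible L L₀ a → a ≤ g → a ≢ g → a - h₁ ≤ a - x₁ X × a - h₂ ≤ a - x₂ X) →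
    PrimitiveCoupleII L L₀ (x₁ X) (x₂ X) × InducesII L L₀ (x₁ X) (x₂ X) h₁ h₂ g
  primitive-inducing {g} g-irr h₁∈ h₂∈ X agrees =
    ( S₁.x∉L₀ , S₂.x∉L₀ , IsSplit.x≢y (isSplit X) (x₂≢𝟘 X)
    , g , g-irr , IsSplit.c-x≡y (isSplit X) , IsSplit.c-y≡x (isSplit X)
    , λ a a-irr (a≤g , a≢g) → S₁.diff-mem a-irr a≤g a≢g , S₂.diff-mem a-irr a≤g a≢g )
    , IsSplit.c≡x∨y (isSplit X) , λ a a-irr → S₁.induced a-irr , S₂.induced a-irr
    where
      module S₁ = Side g-irr (isSplit X) (x₁≢𝟘 X) (x₂≢𝟘 X) (b₁≤x₁ X) h₁∈
                       (λ a-irr a≤g a≢g → proj₁ (agrees a-irr a≤g a≢g))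
      module S₂ = Side g-irr (swap (isSplit X)) (x₂≢𝟘 X) (x₁≢𝟘 X) (b₂≤x₂ X) h₂∈
                       (λ a-irr a≤g a≢g → proj₂ (agrees a-irr a≤g a≢g))

theorem4p6 : (L : CBS) → SplittingAxiom L →
    (L₀ : FiniteSubCBS L) → ∀ h₁ h₂ g → SignatureII L L₀ h₁ h₂ g →
    ∃[ x₁ ] ∃[ x₂ ] (PrimitiveCoupleII L L₀ x₁ x₂ × InducesII L L₀ x₁ x₂ h₁ h₂ g)
theorem4p6 L SA L₀ h₁ h₂ g (h₁∈ , h₂∈ , g-irr , pred@(_ , (h≤g , _) , _)) =
  x₁ X , x₂ X , primitive-inducing g-irr h₁∈ h₂∈ X agrees
  where
    open CBS L
    open Properties L
    open FiniteSubCBS L₀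
    open Irreducibility L L₀

    -- Every join-irreducible a < g of L₀ occurs in this list, as a ↾ (h₁ ∨ h₂) = a.
    refined : Σ (Splitting g h₁ h₂) λ X →
              All (λ u → u - h₁ ≤ u - x₁ X × u - h₂ ≤ u - x₂ X) (map (_↾ (h₁ ∨ h₂)) elems)
    refined = Construction.refinement L SA (ji≢𝟘 g-irr) h≤g (predecessor# g-irr pred)
                (map⁺ (All.universal (λ _ → ↾-≤ʳ) elems))

    X : Splitting g h₁ h₂
    X = proj₁ refined

    agrees : ∀ {a} → JoinIrreducible L L₀ a → a ≤ g → a ≢ g →
             a - h₁ ≤ a - x₁ X × a - h₂ ≤ a - x₂ X
    agrees a-irr a≤g a≢g =
      subst (λ b → b - h₁ ≤ b - x₁ X × b - h₂ ≤ b - x₂ X)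
            (x≤y⇒x↾y≡x (≤predecessor g-irr pred a-irr a≤g a≢g))
            (All.lookup (map⁻ (proj₂ refined)) (elems-complete (proj₁ a-irr)))
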